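{- Fix a positive integer $n$, suppose $0<a\leq n$ is an integer, and set $i= \lfloor n/a\rfloor$. Let $d$ be the largest $i$-smooth divisor of $a$, let $\ell = a/d$, and let $t=\lfloor n/\ell\rfloor$. Then the connected component of $a$ in the divisor graph of $\{a,a+1,\ldots,n\}$ is isomorphic to the connected component of $d$ in the divisor graph of $\{d,d+1,\ldots,t\}$, via an isomorphism sending $a$ to $d$.
   Context: The divisor graph of a set $S$ of positive integers has vertex set $S$, with two distinct elements joined by an edge if one divides the other. An integer is $i$-smooth if it has no prime factor greater than $i$. -}

module Defs where

open import Data.Nat using (ℕ; _≤_; _/_; NonZero)
open import Data.Nat.Divisibility using (_∣_)
open import Data.Nat.Primality using (Prime)
open import Data.Product using (_×_; ∃-syntax; Σ-syntax)
open import Data.Sum using (_⊎_)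
open import Relation.Binary.PropositionalEquality using (_≡_; _≢_)
open import Function.Bundles using (_⇔_)

IsSmooth : ℕ → ℕ → Set
IsSmooth i m = ∀ p → Prime p → p ∣ m → p ≤ i

IsLargestSmoothDivisor : ℕ → ℕ → ℕ → Set
IsLargestSmoothDivisor i a d =
  d ∣ a × IsSmooth i d × (∀ e → e ∣ a → IsSmooth i e → e ≤ d)

InRange : ℕ → ℕ → ℕ → Set
InRange lo hi x = lo ≤ x × x ≤ hi

DivEdge : ℕ → ℕ → Set
DivEdge x y = x ≢ y × (x ∣ y ⊎ y ∣ x)

Adj : ℕ → ℕ → ℕ → ℕ → Set
Adj lo hi x y = InRange lo hi x × InRange lo hi y × DivEdge x y

data Reach (lo hi : ℕ) : ℕ → ℕ → Set where
  here : ∀ {x} → InRange lo hi x → Reach lo hi x x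
  step : ∀ {x y z} → Reach lo hi x y → Adj lo hi y z → Reach lo hi x z

-- The isomorphism is given by a function f : ℕ → ℕ whose restriction to the
-- first component is a bijection onto the second component preserving and
-- reflecting adjacency.
ComponentIso : ℕ → ℕ → ℕ → ℕ → ℕ → ℕ → Set
ComponentIso lo hi v lo' hi' w =
  Σ[ f ∈ (ℕ → ℕ) ]
    (∀ x → Reach lo hi v x → Reach lo' hi' w (f x))
  × (∀ x y → Reach lo hi v x → Reach lo hi v y → f x ≡ f y → x ≡ y)
  × (∀ y → Reach lo' hi' w y → ∃[ x ] (Reach lo hi v x × f x ≡ y))
  × (∀ x y → Reach lo hi v x → Reach lo hi v y → (DivEdge x y ⇔ DivEdge (f x) (f y)))
  × f v ≡ w

module Submission where

-- Write a = d·ℓ, where d is the largest (n/a)-smooth divisor of a.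
-- The proof has three independent ingredients.
--
-- * Smoothness: ℓ is coprime to every c with 1 ≤ c ≤ n/a.  A common divisor
--   g of ℓ and c is (n/a)-smooth, so d·g is an (n/a)-smooth divisor of a,
--   whence d·g ≤ d by maximality and g = 1.
-- * Propagation: if ℓ ∣ y and z ∣ y with y = c·z inside {a, …, n}, then
--   c·a ≤ n, so ℓ is coprime to c and ℓ ∣ z; divisibility by ℓ also passes
--   from y to its multiples.  Hence ℓ divides every vertex of the component
--   of a in the divisor graph of {a, …, n}.
-- * Scaling: whenever ℓ divides every vertex of the component of lo·ℓ in
--   the divisor graph of {lo·ℓ, …, hi}, the map x ↦ x/ℓ is an isomorphism of
--   that component onto the component of lo in {lo, …, hi/ℓ}, with inverse
--   q ↦ q·ℓ, because divisibility and the vertex ranges scale with ℓ.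
--
-- The theorem is the scaling lemma with lo = d, hi = n, its divisibility
-- hypothesis supplied by the first two ingredients.

open import Defs
open import Data.Nat using (ℕ; zero; suc; _≤_; _/_; _*_; NonZero; ≢-nonZero⁻¹)
open import Data.Nat.Properties
open import Data.Nat.DivMod using (m*n/n≡m; m/n*n≡m; m/n*n≤m; m*[n/m]≡n; /-monoˡ-≤)
open import Data.Nat.Divisibility
open import Data.Nat.Coprimality using (Coprime; coprime-divisor)
open import Data.Nat.Primality using (euclidsLemma)
open import Data.Product using (_×_; _,_; proj₁; ∃-syntax)
open import Data.Sum using (_⊎_; inj₁; inj₂) renaming (map to ⊎-map)
open import Data.Empty using (⊥-elim)
open import Function.Bundles using (_⇔_; mk⇔; Equivalence)
open import Relation.Binary.PropositionalEquality

smooth-≤ : ∀ {i m} .{{_ : NonZero m}} → m ≤ i → IsSmooth i m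
smooth-≤ m≤i p _ p∣m = ≤-trans (∣⇒≤ p∣m) m≤i

smooth-∣ : ∀ {i g m} → g ∣ m → IsSmooth i m → IsSmooth i g
smooth-∣ g∣m sm p pp p∣g = sm p pp (∣-trans p∣g g∣m)

smooth-* : ∀ {i m k} → IsSmooth i m → IsSmooth i k → IsSmooth i (m * k)
smooth-* {m = m} {k} sm sk p pp p∣mk with euclidsLemma m k pp p∣mk
... | inj₁ p∣m = sm p pp p∣m
... | inj₂ p∣k = sk p pp p∣k

cofactor-coprime : ∀ {i a d ℓ} .{{_ : NonZero d}} → IsLargestSmoothDivisor i a d →
                   a ≡ d * ℓ → ∀ c → .{{_ : NonZero c}} → c ≤ i → Coprime ℓ c
cofactor-coprime {i} {a} {d} {ℓ} (_ , smooth-d , largest) a≡dℓ c c≤i {g} (g∣ℓ , g∣c) =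
  nonzero-unit (n≤1⇒n≡0∨n≡1 g≤1)
  where
  dg∣a : d * g ∣ a
  dg∣a = subst (d * g ∣_) (sym a≡dℓ) (*-monoʳ-∣ d g∣ℓ)
  smooth-dg : IsSmooth i (d * g)
  smooth-dg = smooth-* smooth-d (smooth-∣ g∣c (smooth-≤ c≤i))
  g≤1 : g ≤ 1
  g≤1 = *-cancelˡ-≤ d (subst (d * g ≤_) (sym (*-identityʳ d)) (largest (d * g) dg∣a smooth-dg))
  nonzero-unit : g ≡ 0 ⊎ g ≡ 1 → g ≡ 1
  nonzero-unit (inj₁ g≡0) = ⊥-elim (≢-nonZero⁻¹ c (0∣⇒≡0 (subst (_∣ c) g≡0 g∣c)))
  nonzero-unit (inj₂ g≡1) = g≡1

-- ℓ is coprime to every factor c ≥ 1 by which a vertex of {lo, …, hi} can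
-- be a multiple of another one, since such a factor satisfies c·lo ≤ hi.
CoprimeToMultipliers : ℕ → ℕ → ℕ → Set
CoprimeToMultipliers ℓ lo hi = ∀ c → .{{_ : NonZero c}} → c * lo ≤ hi → Coprime ℓ c

cofactor-coprimeToMultipliers :
  ∀ {n a d ℓ} .{{_ : NonZero a}} .{{_ : NonZero d}} →
  IsLargestSmoothDivisor (n / a) a d → a ≡ d * ℓ → CoprimeToMultipliers ℓ a n
cofactor-coprimeToMultipliers {n} {a} H a≡dℓ c ca≤n =
  cofactor-coprime H a≡dℓ c (subst (_≤ n / a) (m*n/n≡m c a) (/-monoˡ-≤ a ca≤n))

-- Along one edge of the divisor graph of {lo, …, hi}, divisibility by ℓ
-- is preserved: going up trivially, going down y = c·z by coprimality.
adj-divisible : ∀ {ℓ lo hi y z} .{{_ : NonZero lo}} → CoprimeToMultipliers ℓ lo hi →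
                ℓ ∣ y → Adj lo hi y z → ℓ ∣ z
adj-divisible _ ℓ∣y (_ , _ , _ , inj₁ y∣z) = ∣-trans ℓ∣y y∣z
adj-divisible {ℓ} {lo} {hi} {y} {z} cop ℓ∣y ((lo≤y , y≤hi) , (lo≤z , _) , _ , inj₂ (divides c y≡cz))
  = go c y≡cz
  where
  go : ∀ c → y ≡ c * z → ℓ ∣ z
  go zero y≡0 = ⊥-elim (≢-nonZero⁻¹ lo (n≤0⇒n≡0 (subst (lo ≤_) y≡0 lo≤y)))
  go c@(suc _) y≡cz = coprime-divisor (cop c c*lo≤hi) (subst (ℓ ∣_) y≡cz ℓ∣y)
    where
    c*lo≤hi : c * lo ≤ hi
    c*lo≤hi = ≤-trans (*-monoʳ-≤ c lo≤z) (subst (_≤ hi) y≡cz y≤hi)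

reach-divisible : ∀ {ℓ lo hi v x} .{{_ : NonZero lo}} → CoprimeToMultipliers ℓ lo hi →
                  ℓ ∣ v → Reach lo hi v x → ℓ ∣ x
reach-divisible _ ℓ∣v (here _) = ℓ∣v
reach-divisible cop ℓ∣v (step r adj) = adj-divisible cop (reach-divisible cop ℓ∣v r) adj

module Scaling (ℓ : ℕ) .{{_ : NonZero ℓ}} where

  inRange-× : ∀ {lo hi q} → InRange lo (hi / ℓ) q → InRange (lo * ℓ) hi (q * ℓ)
  inRange-× {hi = hi} (lo≤q , q≤hi/ℓ) =
    *-monoˡ-≤ ℓ lo≤q , ≤-trans (*-monoˡ-≤ ℓ q≤hi/ℓ) (m/n*n≤m hi ℓ)

  inRange-÷ : ∀ {lo hi x} → InRange (lo * ℓ) hi x → InRange lo (hi / ℓ) (x / ℓ)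
  inRange-÷ {lo} (loℓ≤x , x≤hi) =
    subst (_≤ _) (m*n/n≡m lo ℓ) (/-monoˡ-≤ ℓ loℓ≤x) , /-monoˡ-≤ ℓ x≤hi

  divEdge-× : ∀ {q r} → DivEdge q r ⇔ DivEdge (q * ℓ) (r * ℓ)
  divEdge-× {q} {r} = mk⇔ up down
    where
    up : DivEdge q r → DivEdge (q * ℓ) (r * ℓ)
    up (q≢r , q∣r⊎r∣q) =
      (λ qℓ≡rℓ → q≢r (*-cancelʳ-≡ q r ℓ qℓ≡rℓ)) ,
      ⊎-map (*-monoˡ-∣ ℓ) (*-monoˡ-∣ ℓ) q∣r⊎r∣q
    down : DivEdge (q * ℓ) (r * ℓ) → DivEdge q r
    down (qℓ≢rℓ , qℓ∣rℓ⊎rℓ∣qℓ) =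
      (λ q≡r → qℓ≢rℓ (cong (_* ℓ) q≡r)) ,
      ⊎-map (*-cancelʳ-∣ ℓ) (*-cancelʳ-∣ ℓ) qℓ∣rℓ⊎rℓ∣qℓ

  divEdge-÷ : ∀ {x y} → ℓ ∣ x → ℓ ∣ y → DivEdge x y ⇔ DivEdge (x / ℓ) (y / ℓ)
  divEdge-÷ ℓ∣x ℓ∣y = mk⇔
    (λ e → Equivalence.from divEdge-× (subst₂ DivEdge (sym (m/n*n≡m ℓ∣x)) (sym (m/n*n≡m ℓ∣y)) e))
    (λ e → subst₂ DivEdge (m/n*n≡m ℓ∣x) (m/n*n≡m ℓ∣y) (Equivalence.to divEdge-× e))

  reach-× : ∀ {lo hi v q} → Reach lo (hi / ℓ) v q → Reach (lo * ℓ) hi (v * ℓ) (q * ℓ)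
  reach-× (here r) = here (inRange-× r)
  reach-× (step r (ry , rz , e)) =
    step (reach-× r) (inRange-× ry , inRange-× rz , Equivalence.to divEdge-× e)

  reach-÷ : ∀ {lo hi v x} → (∀ {y} → Reach (lo * ℓ) hi v y → ℓ ∣ y) →
            Reach (lo * ℓ) hi v x → Reach lo (hi / ℓ) (v / ℓ) (x / ℓ)
  reach-÷ divisible (here r) = here (inRange-÷ r)
  reach-÷ divisible (step r adj@(ry , rz , e)) =
    step (reach-÷ divisible r)
         (inRange-÷ ry , inRange-÷ rz ,
          Equivalence.to (divEdge-÷ (divisible r) (divisible (step r adj))) e)

  scaledComponentIso : ∀ {lo hi a} → a ≡ lo * ℓ → (∀ {x} → Reach a hi a x → ℓ ∣ x) →
                       ComponentIso a hi a lo (hi / ℓ) lo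
  scaledComponentIso {lo} {hi} refl divisible =
    (_/ ℓ) , into , injective , onto , (λ x y rx ry → divEdge-÷ (divisible rx) (divisible ry)) ,
    m*n/n≡m lo ℓ
    where
    into : ∀ x → Reach (lo * ℓ) hi (lo * ℓ) x → Reach lo (hi / ℓ) lo (x / ℓ)
    into x r = subst (λ v → Reach lo (hi / ℓ) v (x / ℓ)) (m*n/n≡m lo ℓ) (reach-÷ divisible r)

    injective : ∀ x y → Reach (lo * ℓ) hi (lo * ℓ) x → Reach (lo * ℓ) hi (lo * ℓ) y →
                x / ℓ ≡ y / ℓ → x ≡ y
    injective x y rx ry x/ℓ≡y/ℓ = begin
      x          ≡⟨ m/n*n≡m (divisible rx) ⟨
      x / ℓ * ℓ  ≡⟨ cong (_* ℓ) x/ℓ≡y/ℓ ⟩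
      y / ℓ * ℓ  ≡⟨ m/n*n≡m (divisible ry) ⟩
      y          ∎
      where open ≡-Reasoning

    onto : ∀ q → Reach lo (hi / ℓ) lo q → ∃[ x ] (Reach (lo * ℓ) hi (lo * ℓ) x × x / ℓ ≡ q)
    onto q r = q * ℓ , reach-× r , m*n/n≡m q ℓ

lemma10p1 : ∀ (n a : ℕ) → .{{_ : NonZero a}} → a ≤ n →
            ∀ (d : ℕ) → .{{_ : NonZero d}} → IsLargestSmoothDivisor (n / a) a d →
            ∀ (ℓ : ℕ) → .{{_ : NonZero ℓ}} → ℓ ≡ a / d →
            ComponentIso a n a d (n / ℓ) d
lemma10p1 n a _ d H ℓ ℓ≡a/d = scaledComponentIso a≡dℓ divisible
  where
  open Scaling ℓ
  open ≡-Reasoning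

  a≡dℓ : a ≡ d * ℓ
  a≡dℓ = begin
    a            ≡⟨ m*[n/m]≡n (proj₁ H) ⟨
    d * (a / d)  ≡⟨ cong (d *_) ℓ≡a/d ⟨
    d * ℓ        ∎

  divisible : ∀ {x} → Reach a n a x → ℓ ∣ x
  divisible = reach-divisible (cofactor-coprimeToMultipliers H a≡dℓ) (divides d a≡dℓ)
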